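{- One has: (1) $P\circ A\circ\hat{R}^{ -1}=D$; (2) $P\circ\mathrm{PS}\circ\star\circ\hat{R}^{ -1}=G$.
   Context: Let $m,n$ be coprime. An affine permutation is a bijection $\omega:\mathbb{Z}\to\mathbb{Z}$ with $\omega(x+n)=\omega(x)+n$ and $\sum_{i=1}^n\omega(i)=\frac{n(n+1)}{2}$; it is $m$-stable if $\omega(x+m)>\omega(x)$ for all $x$; $\widetilde{S}_n^m$ is the set of these. $\mathrm{PF}_{m/n}$ is the set of $m/n$-parking functions ($f:\{1,\dots,n\}\to\mathbb{Z}_{\ge0}$ whose row lengths sorted decreasingly form a Young diagram under the diagonal of an $n\times m$ rectangle), $Y_{m/n}$ the set of such Young diagrams, and $P:\mathrm{PF}_{m/n}\to Y_{m/n}$ the map sending $f$ to this diagram. The Anderson map $A$: for $\omega\in\widetilde{S}_n^m$ let $M_\omega=\min\{i:\omega(i)>0\}$; for $\alpha\in\{1,\dots,n\}$ write $\omega^{ -1}(\alpha)-M_\omega=rm-kn$ with $r\in\{0,\dots,n-1\}$ and set $A_\omega(\alpha)=k$. The map $\mathrm{PS}$: $\mathrm{PS}_\omega(\alpha)=\sharp\{i:\omega(i)>\alpha,\ \omega^{ -1}(\alpha)-m<i<\omega^{ -1}(\alpha)\}$. Let $I_{m,n}$ be the set of $\Delta\subset\mathbb{Z}_{\ge0}$ with $\Delta+m\subset\Delta$, $\Delta+n\subset\Delta$, $\min\Delta=0$; its $n$-generators (elements $a\in\Delta$ with $a-n\notin\Delta$) are $u_1<\dots<u_n$. With $\Delta_\omega=\{i:\omega(i)>0\}$,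 the set $\widetilde{S}^{\min,m}_n=\{\omega\in\widetilde{S}_n^m:\omega^{ -1}(1)<\dots<\omega^{ -1}(n)\}$ (the $m$-stable minimal length right coset representatives of $S_n\backslash\widetilde{S}_n$) maps bijectively onto $I_{m,n}$ by $\hat R(\omega)=\Delta_\omega-\min\Delta_\omega$. The involution $\star$ is $\omega^\star(x)=1-\omega(1-x)$; it preserves $\widetilde{S}_n^m$ and $\widetilde{S}^{\min,m}_n$. The map $D:I_{m,n}\to Y_{m/n}$ sends $\Delta$ to the diagram of boxes $(x,y)$, $0\le x<m$, $0\le y<n$, with $mn-m-n-nx-my\in\Delta$. The map $G:I_{m,n}\to Y_{m/n}$ sends $\Delta$ to the Young diagram with row lengths $G_\Delta(\alpha)=\sharp([u_\alpha,u_\alpha+m]\setminus\Delta)$, $\alpha=1,\dots,n$. -}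

module Defs where

open import Data.Bool using (Bool; true; false; _∧_; not)
open import Data.Nat as ℕ using (ℕ; zero; suc)
open import Data.Nat.Properties as ℕP using (≤-decTotalOrder)
open import Data.Integer as ℤ using (ℤ; +_; -[1+_]; _+_; _-_; _*_; _≤_; _<_; ∣_∣)
open import Data.Integer.Properties as ℤP using (_<?_)
open import Data.Fin as Fin using (Fin; toℕ)
open import Data.List using (List; []; _∷_; map; length; filterᵇ; applyUpTo; foldr; reverse; upTo)
open import Data.Product using (Σ; ∃; _×_; _,_)
open import Function.Bundles using (_↔_; Inverse; mk↔ₛ′)
open import Relation.Nullary using (does)
open import Relation.Binary.PropositionalEquality using (_≡_; refl; cong)
open import Data.Integer.Tactic.RingSolver using (solve-∀)

import Data.List.Sort as Sort
open Sort ≤-decTotalOrder using (sort)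

app : ℤ ↔ ℤ → ℤ → ℤ
app ω = Inverse.to ω

inv : ℤ ↔ ℤ → ℤ → ℤ
inv ω = Inverse.from ω

sumℤ : List ℤ → ℤ
sumℤ = foldr _+_ (+ 0)

oneTo : ℕ → List ℕ
oneTo n = applyUpTo suc n

IsAffinePerm : ℕ → ℤ ↔ ℤ → Set
IsAffinePerm n ω =
  (∀ x → app ω (x + + n) ≡ app ω x + + n) ×
  (sumℤ (map (λ i → app ω (+ i)) (oneTo n)) ≡ + ((n ℕ.* suc n) ℕ./ 2))

IsStable : ℕ → ℤ ↔ ℤ → Set
IsStable m ω = ∀ x → app ω x < app ω (x + + m)

IsMinimalRep : ℕ → ℤ ↔ ℤ → Set
IsMinimalRep n ω = ∀ (α : ℕ) → 1 ℕ.≤ α → α ℕ.< n → inv ω (+ α) < inv ω (+ suc α)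

IsMinStableAffPerm : ℕ → ℕ → ℤ ↔ ℤ → Set
IsMinStableAffPerm m n ω = IsAffinePerm n ω × IsStable m ω × IsMinimalRep n ω

IsMinPos : ℤ ↔ ℤ → ℤ → Set
IsMinPos ω M = (+ 0 < app ω M) × (∀ i → i < M → app ω i ≤ + 0)

Subsetℕ : Set
Subsetℕ = ℕ → Bool

_∈ℤ_ : ℤ → Subsetℕ → Bool
(+ k) ∈ℤ Δ = Δ k
-[1+ _ ] ∈ℤ Δ = false

-- R̂(ω) = Δ_ω − M_ω, where Δ_ω = { i : ω(i) > 0 } and M = M_ω = min Δ_ω;
-- k ∈ R̂(ω) iff M + k ∈ Δ_ω (elements of Δ_ω are ≥ M by minimality of M).
Rhat : ℤ ↔ ℤ → ℤ → Subsetℕ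
Rhat ω M k = does (+ 0 <? app ω (M + + k))

IsNGen : ℕ → Subsetℕ → ℕ → Set
IsNGen n Δ a = (Δ a ≡ true) × ((+ a - + n) ∈ℤ Δ ≡ false)

IsNGenList : (n : ℕ) → Subsetℕ → (Fin n → ℕ) → Set
IsNGenList n Δ u =
  (∀ (i j : Fin n) → i Fin.< j → u i ℕ.< u j) ×
  (∀ i → IsNGen n Δ (u i)) ×
  (∀ a → IsNGen n Δ a → ∃ λ i → u i ≡ a)

-- Young diagrams as Boolean predicates on boxes (x , y), x = column,
-- y = row; two diagrams are equal iff they have the same boxes.

Diagram : Set
Diagram = ℕ → ℕ → Bool

_≈D_ : Diagram → Diagram → Set
d₁ ≈D d₂ = ∀ x y → d₁ x y ≡ d₂ x y

nth : List ℕ → ℕ → ℕ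
nth [] _ = 0
nth (a ∷ as) zero = a
nth (a ∷ as) (suc k) = nth as k

diagramOfRows : List ℕ → Diagram
diagramOfRows rs x y = x ℕ.<ᵇ nth (reverse (sort rs)) y

values : ∀ {A : Set} {n} → (Fin n → A) → List A
values {n = n} f = Data.List.map f (Data.List.allFin n)
  where import Data.List

P : ∀ {n} → (Fin n → ℕ) → Diagram
P f = diagramOfRows (values f)

-- The Anderson map.  For α ∈ {1,…,n} (α = toℕ i + 1 for i : Fin n),
-- a(α) = k where ω⁻¹(α) − M_ω = r m − k n with r ∈ {0,…,n−1}.

IsAnderson : ℕ → (n : ℕ) → ℤ ↔ ℤ → ℤ → (Fin n → ℤ) → Set
IsAnderson m n ω M a =
  ∀ (i : Fin n) → ∃ λ (r : Fin n) →
    inv ω (+ suc (toℕ i)) - M ≡ + (toℕ r ℕ.* m) - a i * + n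

-- The map PS:
-- PS_ω(α) = #{ i : ω(i) > α , ω⁻¹(α) − m < i < ω⁻¹(α) }
-- The i in the open interval are ω⁻¹(α) − j for j = 1, …, m−1.

PSval : ℕ → ℤ ↔ ℤ → ℕ → ℕ
PSval m ω α =
  length (filterᵇ (λ j → does (+ α <? app ω (inv ω (+ α) - + j)))
                  (oneTo (m ℕ.∸ 1)))

PS : ℕ → (n : ℕ) → ℤ ↔ ℤ → (Fin n → ℕ)
PS m n ω i = PSval m ω (suc (toℕ i))

private
  1-1- : ∀ a → + 1 - (+ 1 - a) ≡ a
  1-1- = solve-∀

star : ℤ ↔ ℤ → ℤ ↔ ℤ
star ω = mk↔ₛ′ f g invl invr
  where
  f g : ℤ → ℤ
  f x = + 1 - app ω (+ 1 - x)
  g x = + 1 - inv ω (+ 1 - x)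
  invl : ∀ y → f (g y) ≡ y
  invl y rewrite 1-1- (inv ω (+ 1 - y)) | Inverse.strictlyInverseˡ ω (+ 1 - y) = 1-1- y
  invr : ∀ y → g (f y) ≡ y
  invr y rewrite 1-1- (app ω (+ 1 - y)) | Inverse.strictlyInverseʳ ω (+ 1 - y) = 1-1- y

D : ℕ → ℕ → Subsetℕ → Diagram
D m n Δ x y =
  (x ℕ.<ᵇ m) ∧ (y ℕ.<ᵇ n) ∧
  ((+ (m ℕ.* n) - + m - + n - + (n ℕ.* x) - + (m ℕ.* y)) ∈ℤ Δ)

Gval : ℕ → Subsetℕ → ℕ → ℕ
Gval m Δ u = length (filterᵇ (λ k → not (Δ k)) (applyUpTo (u ℕ.+_) (suc m)))

G : ∀ {n} → ℕ → Subsetℕ → (Fin n → ℕ) → Diagram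
G m Δ u = diagramOfRows (values (λ i → Gval m Δ (u i)))

-- Both identities are read off column by column: the cell (x, y) belongs to the diagram with row
-- lengths r₁, …, rₙ iff more than y of the rᵢ exceed x.
--
-- (1) If ω⁻¹(α) = M + r m − k n then ω(M + r m − (x+1) n) = α + (k − x − 1) n, which is positive iff
-- x < k because 1 ≤ α ≤ n.  As α ↦ r is injective, column x of P(A_ω) counts the ρ < n with
-- ρ m − (x+1) n ∈ Δ; since Δ + m ⊆ Δ these ρ form a final segment of [0, n), so the count exceeds y
-- iff (n−1−y) m − (x+1) n = mn − m − n − nx − my lies in Δ, which is the cell (x, y) of D(Δ).
--
-- (2) The involution ⋆ turns PS_{ω⋆}(α) into #{t ∈ [1, m−1] : ω(ω⁻¹(β) + t) < β} with β = n+1−α.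
-- The n-generators of Δ are u = ω⁻¹(β) − M for β = 1, …, n, and G_Δ(u) is the same count: the
-- ends u, u + m lie in Δ, and u + t ∉ Δ iff ω(ω⁻¹(β) + t) < β, because ω⁻¹ is increasing on 1, …, n.
-- So both diagrams have the same multiset of rows.

module Submission where

open import Algebra.Bundles using (AbelianGroup)
open import Data.Bool using (Bool; true; false; not; if_then_else_)
import Data.Bool.Properties as BoolP
open import Data.Empty using (⊥-elim)
open import Data.Fin as Fin using (Fin; toℕ)
import Data.Fin.Permutation as Perm
import Data.Fin.Properties as FinP
open import Data.Integer as ℤ using (ℤ; +_; -[1+_]; _+_; _-_; _*_; -_; +≤+; +<+; ∣_∣)
import Data.Integer.Properties as ℤP
open import Data.Integer.Tactic.RingSolver using (solve-∀)
open import Data.List using (List; []; _∷_; length; filterᵇ; reverse; applyUpTo; tabulate)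
import Data.List.Properties as ListP
open import Data.List.Relation.Binary.Permutation.Propositional using (_↭_; ↭-sym)
import Data.List.Relation.Binary.Permutation.Propositional.Properties as ↭P
open import Data.List.Relation.Unary.All as All using (All; []; _∷_)
open import Data.List.Relation.Unary.AllPairs using (AllPairs; []; _∷_)
import Data.List.Relation.Unary.AllPairs.Properties as AllPairsP
import Data.List.Relation.Unary.Sorted.TotalOrder.Properties as SortedP
import Data.List.Sort as Sort
open import Data.Nat as ℕ using (ℕ; zero; suc; _≤_; _<_; _≥_; _<ᵇ_; z≤n; s≤s; _∸_)
open import Data.Nat.Coprimality using (Coprime)
import Data.Nat.Properties as ℕP
open import Data.Product using (∃; _×_; _,_; proj₁; proj₂)
open import Data.Sum using (inj₁; inj₂)
open import Function using (_∘_)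
open import Function.Bundles using (_↔_; Inverse; _⇔_; mk⇔; Equivalence)
open import Function.Definitions using (Injective)
open import Relation.Binary.Bundles using (DecTotalOrder)
open import Relation.Binary.Definitions using (tri<; tri≈; tri>)
open import Relation.Binary.PropositionalEquality
open import Relation.Nullary using (¬_; Dec; yes; no; does; ¬?)
open import Relation.Nullary.Decidable using (T?; dec-true; dec-false; does-⇔)

open import Defs

open import Algebra.Properties.CommutativeMonoid.Sum ℕP.+-0-commutativeMonoid
  using (sum; sum-permute; sum-cong-≗)
open import Algebra.Properties.Group (AbelianGroup.group ℤP.+-0-abelianGroup) using (∙-cancelˡ)
open Sort ℕP.≤-decTotalOrder using (sort; sort-↭; sort-↗)

does-true⇒ : ∀ {A : Set} (a? : Dec A) → does a? ≡ true → A
does-true⇒ (yes a) _ = a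

does-false⇒ : ∀ {A : Set} (a? : Dec A) → does a? ≡ false → ¬ A
does-false⇒ (no ¬a) _ = ¬a

-- Counting and Young diagrams

count : ∀ {A : Set} → (A → Bool) → List A → ℕ
count p xs = length (filterᵇ p xs)

count-↭ : ∀ {A : Set} (p : A → Bool) {xs ys} → xs ↭ ys → count p xs ≡ count p ys
count-↭ p xs↭ys = ↭P.↭-length (↭P.filter-↭ (T? ∘ p) xs↭ys)

count-none : ∀ {A : Set} {p : A → Bool} {xs} → All (λ x → p x ≡ false) xs → count p xs ≡ 0
count-none [] = refl
count-none {p = p} {x ∷ _} (px ∷ pxs) rewrite px = count-none pxs

count-applyUpTo-cong : ∀ {A B : Set} (p : A → Bool) (q : B → Bool) f g k →
  (∀ {t} → t < k → p (f t) ≡ q (g t)) →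
  count p (applyUpTo f k) ≡ count q (applyUpTo g k)
count-applyUpTo-cong p q f g zero eq = refl
count-applyUpTo-cong p q f g (suc k) eq with p (f 0) | q (g 0) | eq (s≤s z≤n)
... | true  | true  | refl = cong suc (count-applyUpTo-cong p q (f ∘ suc) (g ∘ suc) k (eq ∘ s≤s))
... | false | false | refl = count-applyUpTo-cong p q (f ∘ suc) (g ∘ suc) k (eq ∘ s≤s)

count-applyUpTo-last : ∀ {A : Set} (p : A → Bool) f k → p (f k) ≡ false →
  count p (applyUpTo f (suc k)) ≡ count p (applyUpTo f k)
count-applyUpTo-last p f zero pfk rewrite pfk = refl
count-applyUpTo-last p f (suc k) pfk with p (f 0)
... | true  = cong suc (count-applyUpTo-last p (f ∘ suc) k pfk)
... | false = count-applyUpTo-last p (f ∘ suc) k pfk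

count-applyUpTo-interior : ∀ (p q : ℕ → Bool) u m → 1 ≤ m → p u ≡ false → p (u ℕ.+ m) ≡ false →
  (∀ {t} → 1 ≤ t → t < m → p (u ℕ.+ t) ≡ q t) →
  count p (applyUpTo (u ℕ.+_) (suc m)) ≡ count q (applyUpTo suc (m ∸ 1))
count-applyUpTo-interior p q u (suc k) _ pu pu+m interior rewrite ℕP.+-identityʳ u | pu =
  trans (count-applyUpTo-last p (λ t → u ℕ.+ suc t) k pu+m)
        (count-applyUpTo-cong p q (λ t → u ℕ.+ suc t) suc k (λ t<k → interior (s≤s z≤n) (s≤s t<k)))

nth-<ᵇ-count-≤ : ∀ {x} ds y → All (_≤ x) ds → (x <ᵇ nth ds y) ≡ (y <ᵇ count (x <ᵇ_) ds)
nth-<ᵇ-count-≤ {x} ds y ds≤x =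
  trans (dec-false (x ℕP.<? _) (ℕP.≤⇒≯ (nth-≤ ds y ds≤x)))
        (sym (cong (y <ᵇ_) (count-none (All.map (λ e≤x → dec-false (x ℕP.<? _) (ℕP.≤⇒≯ e≤x)) ds≤x))))
  where
  nth-≤ : ∀ es k → All (_≤ x) es → nth es k ≤ x
  nth-≤ []       k       []         = z≤n
  nth-≤ (e ∷ es) zero    (e≤x ∷ _)  = e≤x
  nth-≤ (e ∷ es) (suc k) (_ ∷ es≤x) = nth-≤ es k es≤x

nth-<ᵇ-count : ∀ ds x y → AllPairs _≥_ ds → (x <ᵇ nth ds y) ≡ (y <ᵇ count (x <ᵇ_) ds)
nth-<ᵇ-count []       x y [] = refl
nth-<ᵇ-count (d ∷ ds) x y (d≥ds ∷ desc) with x ℕP.<? d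
... | no x≮d = nth-<ᵇ-count-≤ (d ∷ ds) y (d≤x ∷ All.map (λ e≤d → ℕP.≤-trans e≤d d≤x) d≥ds)
  where
  d≤x : d ≤ x
  d≤x = ℕP.≮⇒≥ x≮d
nth-<ᵇ-count (d ∷ ds) x zero    (_ ∷ desc) | yes x<d rewrite dec-true (x ℕP.<? d) x<d = refl
nth-<ᵇ-count (d ∷ ds) x (suc y) (_ ∷ desc) | yes x<d rewrite dec-true (x ℕP.<? d) x<d =
  nth-<ᵇ-count ds x y desc

reverse-ascending : ∀ xs → AllPairs _≤_ xs → AllPairs _≥_ (reverse xs)
reverse-ascending []       []          = []
reverse-ascending (x ∷ xs) (x≤xs ∷ asc) rewrite ListP.unfold-reverse x xs =
  AllPairsP.++⁺ (reverse-ascending xs asc) ([] ∷ [])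
    (All.map (_∷ []) (↭P.All-resp-↭ (↭-sym (↭P.↭-reverse xs)) x≤xs))

diagramOfRows-count : ∀ rs x y → diagramOfRows rs x y ≡ (y <ᵇ count (x <ᵇ_) rs)
diagramOfRows-count rs x y = begin
  x <ᵇ nth (reverse (sort rs)) y              ≡⟨ nth-<ᵇ-count _ x y (reverse-ascending _ sorted) ⟩
  y <ᵇ count (x <ᵇ_) (reverse (sort rs))      ≡⟨ cong (y <ᵇ_) (count-↭ _ (↭P.↭-reverse (sort rs))) ⟩
  y <ᵇ count (x <ᵇ_) (sort rs)                ≡⟨ cong (y <ᵇ_) (count-↭ _ (sort-↭ rs)) ⟩
  y <ᵇ count (x <ᵇ_) rs                       ∎
  where
  open ≡-Reasoning
  sorted : AllPairs _≤_ (sort rs)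
  sorted = SortedP.Sorted⇒AllPairs (DecTotalOrder.totalOrder ℕP.≤-decTotalOrder) (sort-↗ rs)

countFin : ∀ {n} → (Fin n → Bool) → ℕ
countFin p = sum (λ i → if p i then 1 else 0)

count-tabulate : ∀ {n} (q : ℕ → Bool) (f : Fin n → ℕ) → count q (tabulate f) ≡ countFin (q ∘ f)
count-tabulate {zero}  q f = refl
count-tabulate {suc n} q f with q (f Fin.zero)
... | true  = cong suc (count-tabulate q (f ∘ Fin.suc))
... | false = count-tabulate q (f ∘ Fin.suc)

count-values : ∀ {n} (q : ℕ → Bool) (f : Fin n → ℕ) → count q (values f) ≡ countFin (q ∘ f)
count-values {n} q f =
  trans (cong (count q) (ListP.map-tabulate {n = n} (λ i → i) f)) (count-tabulate q f)

countFin-≤ : ∀ {n} (p : Fin n → Bool) → countFin p ≤ n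
countFin-≤ {zero}  p = z≤n
countFin-≤ {suc n} p with p Fin.zero
... | true  = s≤s (countFin-≤ (p ∘ Fin.suc))
... | false = ℕP.m≤n⇒m≤1+n (countFin-≤ (p ∘ Fin.suc))

countFin-all : ∀ {n} (p : Fin n → Bool) → (∀ i → p i ≡ true) → countFin p ≡ n
countFin-all {zero}  p all = refl
countFin-all {suc n} p all rewrite all Fin.zero = cong suc (countFin-all (p ∘ Fin.suc) (all ∘ Fin.suc))

injective⇒surjective : ∀ {n} {σ : Fin n → Fin n} → Injective _≡_ _≡_ σ → ∀ j → ∃ λ i → σ i ≡ j
injective⇒surjective {zero}  inj ()
injective⇒surjective {suc n} {σ} inj j with FinP.any? (λ i → σ i FinP.≟ j)
... | yes found = found
... | no ¬found = ⊥-elim (ℕP.<-irrefl refl (FinP.injective⇒≤ {f = avoid-j} avoid-j-injective))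
  where
  σi≢j : ∀ i → j ≢ σ i
  σi≢j i j≡σi = ¬found (i , sym j≡σi)
  avoid-j : Fin (suc n) → Fin n
  avoid-j i = Fin.punchOut (σi≢j i)
  avoid-j-injective : Injective _≡_ _≡_ avoid-j
  avoid-j-injective eq = inj (FinP.punchOut-injective (σi≢j _) (σi≢j _) eq)

countFin-reindex : ∀ {n} {p q : Fin n → Bool} (σ : Fin n → Fin n) → Injective _≡_ _≡_ σ →
  (∀ i → p i ≡ q (σ i)) → countFin p ≡ countFin q
countFin-reindex {p = p} {q} σ inj p≗q∘σ =
  trans (sum-cong-≗ (λ i → cong (λ b → if b then 1 else 0) (p≗q∘σ i)))
        (sym (sum-permute (λ i → if q i then 1 else 0) π))
  where
  σ⁻¹ : _
  σ⁻¹ j = proj₁ (injective⇒surjective inj j)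
  π : Perm.Permutation′ _
  π = Perm.permutation σ σ⁻¹ (λ j → proj₂ (injective⇒surjective inj j))
                             (λ i → inj (proj₂ (injective⇒surjective inj (σ i))))

UpwardClosed : (ℕ → Bool) → Set
UpwardClosed q = ∀ ρ → q ρ ≡ true → q (suc ρ) ≡ true

upwardClosed-0 : ∀ {q} → UpwardClosed q → q 0 ≡ true → ∀ k → q k ≡ true
upwardClosed-0 up q0 zero    = q0
upwardClosed-0 up q0 (suc k) = up k (upwardClosed-0 up q0 k)

countFin-upwardClosed : ∀ n (q : ℕ → Bool) → UpwardClosed q → ∀ {y} → y < n →
  (y <ᵇ countFin {n} (q ∘ toℕ)) ≡ q (n ∸ suc y)
countFin-upwardClosed (suc n) q up {y} y<1+n with q 0 in q0
... | true  = trans (cong (λ c → y <ᵇ suc c) (countFin-all _ (λ i → upwardClosed-0 up q0 (suc (toℕ i)))))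
                   (trans (dec-true (y ℕP.<? suc n) y<1+n) (sym (upwardClosed-0 up q0 (n ∸ y))))
... | false with y ℕP.<? n
...   | yes y<n = trans (countFin-upwardClosed n (q ∘ suc) (up ∘ suc) y<n)
                        (cong q (sym (ℕP.+-∸-assoc 1 y<n)))
...   | no  y≮n rewrite ℕP.≤-antisym (ℕP.≤-pred y<1+n) (ℕP.≮⇒≥ y≮n) | ℕP.n∸n≡0 n =
          trans (dec-false (n ℕP.<? _) (ℕP.≤⇒≯ (countFin-≤ {n} (q ∘ suc ∘ toℕ)))) (sym q0)

P-count : ∀ {n} (f : Fin n → ℕ) x y → P f x y ≡ (y <ᵇ countFin (λ i → x <ᵇ f i))
P-count f x y = trans (diagramOfRows-count (values f) x y) (cong (y <ᵇ_) (count-values (x <ᵇ_) f))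

P-reindex : ∀ {n} {f g : Fin n → ℕ} (σ : Fin n → Fin n) → Injective _≡_ _≡_ σ →
  (∀ i → f i ≡ g (σ i)) → P f ≈D P g
P-reindex {f = f} {g} σ inj f≗g∘σ x y =
  trans (P-count f x y)
        (trans (cong (y <ᵇ_) (countFin-reindex σ inj (λ i → cong (x <ᵇ_) (f≗g∘σ i))))
               (sym (P-count g x y)))

strictlyIncreasing⇒injective : ∀ {n} {u : Fin n → ℕ} → (∀ i j → i Fin.< j → u i < u j) →
  Injective _≡_ _≡_ u
strictlyIncreasing⇒injective {u = u} incr {i} {j} ui≡uj with FinP.<-cmp i j
... | tri≈ _ i≡j _ = i≡j
... | tri< i<j _ _ = ⊥-elim (ℕP.<-irrefl ui≡uj (incr i j i<j))
... | tri> _ _ j<i = ⊥-elim (ℕP.<-irrefl (sym ui≡uj) (incr j i j<i))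

opposite-injective : ∀ {n} → Injective _≡_ _≡_ (Fin.opposite {n})
opposite-injective {n} {i} {j} eq =
  trans (sym (FinP.opposite-involutive i)) (trans (cong Fin.opposite eq) (FinP.opposite-involutive j))

window-index : ∀ {n γ} → 1 ≤ γ → γ ≤ n → ∃ λ (k : Fin n) → suc (toℕ k) ≡ γ
window-index {γ = suc c} _ c<n = Fin.fromℕ< c<n , cong suc (FinP.toℕ-fromℕ< c<n)

-- Integers and affine permutations

window-pos : ∀ {n α} → 1 ≤ α → α ≤ n → ∀ t → (+ 0 ℤ.< + α + t * + n) ⇔ (+ 0 ℤ.≤ t)
window-pos {n} {α} 1≤α α≤n t = mk⇔ (to t) (from t)
  where
  to : ∀ t → + 0 ℤ.< + α + t * + n → + 0 ℤ.≤ t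
  to (+ k)    _   = +≤+ z≤n
  to -[1+ k ] pos = ⊥-elim (ℤP.<⇒≱ pos nonpos)
    where
    rewrite-neg : ∀ A K N → A + (- (+ 1 + K)) * N ≡ A - (N + K * N)
    rewrite-neg = solve-∀
    nonpos : + α + -[1+ k ] * + n ℤ.≤ + 0
    nonpos rewrite rewrite-neg (+ α) (+ k) (+ n) | sym (ℤP.pos-* k n) =
      ℤP.i≤j⇒i-j≤0 (+≤+ (ℕP.≤-trans α≤n (ℕP.m≤m+n n _)))
  from : ∀ t → + 0 ℤ.≤ t → + 0 ℤ.< + α + t * + n
  from (+ k) _ rewrite sym (ℤP.pos-* k n) = +<+ (ℕP.≤-trans 1≤α (ℕP.m≤m+n α _))

window-rigid : ∀ {n α β} t → 1 ≤ α → α ≤ n → 1 ≤ β → β ≤ n → + α + t * + n ≡ + β → α ≡ β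
window-rigid {n} {α} {β} t 1≤α α≤n 1≤β β≤n α+tn≡β =
  ℤP.+-injective (begin
    + α                ≡⟨ x+0*N (+ α) (+ n) ⟨
    + α + + 0 * + n    ≡⟨ cong (λ s → + α + s * + n) t≡0 ⟨
    + α + t * + n      ≡⟨ α+tn≡β ⟩
    + β                ∎)
  where
  open ≡-Reasoning
  x+0*N : ∀ x N → x + + 0 * N ≡ x
  x+0*N = solve-∀
  back : ∀ A B T N → A + T * N ≡ B → B + (- T) * N ≡ A
  back A B T N refl = lem A T N
    where
    lem : ∀ A T N → A + T * N + (- T) * N ≡ A
    lem = solve-∀
  0≤t : + 0 ℤ.≤ t
  0≤t = Equivalence.to (window-pos 1≤α α≤n t) (subst (+ 0 ℤ.<_) (sym α+tn≡β) (+<+ 1≤β))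
  0≤-t : + 0 ℤ.≤ - t
  0≤-t = Equivalence.to (window-pos 1≤β β≤n (- t))
           (subst (+ 0 ℤ.<_) (sym (back (+ α) (+ β) t (+ n) α+tn≡β)) (+<+ 1≤α))
  t≡0 : t ≡ + 0
  t≡0 = ℤP.≤-antisym (subst (ℤ._≤ + 0) (ℤP.neg-involutive t) (ℤP.neg-mono-≤ 0≤-t)) 0≤t

<-swap : ∀ a b c → a ℤ.< c - b → b ℤ.< c - a
<-swap a b c a<c-b = subst₂ ℤ._<_ (lem₁ a b) (lem₂ a b c) (ℤP.+-monoˡ-< (b - a) a<c-b)
  where
  lem₁ : ∀ a b → a + (b - a) ≡ b
  lem₁ = solve-∀
  lem₂ : ∀ a b c → c - b + (b - a) ≡ c - a
  lem₂ = solve-∀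

lattice-point : ∀ m n x y → y < n →
  + (m ℕ.* n) - + m - + n - + (n ℕ.* x) - + (m ℕ.* y) ≡ + ((n ∸ suc y) ℕ.* m) - + (suc x ℕ.* n)
lattice-point m n x y y<n
  rewrite ℤP.pos-* m n | ℤP.pos-* n x | ℤP.pos-* m y | ℤP.pos-* (n ∸ suc y) m | ℤP.pos-* (suc x) n =
  begin
    + m * + n - + m - + n - + n * + x - + m * + y  ≡⟨ expand (+ m) (+ n) (+ x) (+ y) K ⟩
    L + + m * (+ n - (+ 1 + + y) - K)             ≡⟨ cong (λ z → L + + m * z) n-1-y-K≡0 ⟩
    L + + m * + 0                                 ≡⟨ drop L (+ m) ⟩
    L                                             ∎
  where
  open ≡-Reasoning
  K L : ℤ
  K = + (n ∸ suc y)
  L = K * + m - (+ 1 + + x) * + n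
  expand : ∀ M N X Y K → M * N - M - N - N * X - M * Y ≡ K * M - (+ 1 + X) * N + M * (N - (+ 1 + Y) - K)
  expand = solve-∀
  drop : ∀ A M → A + M * + 0 ≡ A
  drop = solve-∀
  cancel : ∀ K S → K + S - S - K ≡ + 0
  cancel = solve-∀
  n-1-y-K≡0 : + n - (+ 1 + + y) - K ≡ + 0
  n-1-y-K≡0 = subst (λ z → + z - + suc y - K ≡ + 0) (ℕP.m∸n+n≡m y<n) (cancel K (+ suc y))

∈ℤ-negative : ∀ {v} (Δ : Subsetℕ) → v ℤ.< + 0 → v ∈ℤ Δ ≡ false
∈ℤ-negative { -[1+ _ ]} Δ _ = refl
∈ℤ-negative {+ _}      Δ (+<+ ())

module Periodic {n : ℕ} (f : ℤ → ℤ) (periodic : ∀ x → f (x + + n) ≡ f x + + n) where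

  private
    N : ℤ
    N = + n

  f-+-ℕ* : ∀ x k → f (x + + k * N) ≡ f x + + k * N
  f-+-ℕ* x zero    = trans (cong f (x+0*N x N)) (sym (x+0*N (f x) N))
    where
    x+0*N : ∀ x N → x + + 0 * N ≡ x
    x+0*N = solve-∀
  f-+-ℕ* x (suc k) = begin
    f (x + + suc k * N)     ≡⟨ cong f (unfold x (+ k) N) ⟩
    f ((x + + k * N) + N)   ≡⟨ periodic _ ⟩
    f (x + + k * N) + N     ≡⟨ cong (_+ N) (f-+-ℕ* x k) ⟩
    f x + + k * N + N       ≡⟨ unfold (f x) (+ k) N ⟨
    f x + + suc k * N       ∎
    where
    open ≡-Reasoning
    unfold : ∀ x K N → x + (+ 1 + K) * N ≡ (x + K * N) + N
    unfold = solve-∀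

  f-+-* : ∀ x t → f (x + t * N) ≡ f x + t * N
  f-+-* x (+ k)    = f-+-ℕ* x k
  f-+-* x -[1+ k ] = begin
    f (x + -[1+ k ] * N)                    ≡⟨ shift (f (x + -[1+ k ] * N)) K N ⟨
    f (x + -[1+ k ] * N) + K * N - K * N    ≡⟨ cong (_- K * N) (f-+-ℕ* _ (suc k)) ⟨
    f (x + -[1+ k ] * N + K * N) - K * N    ≡⟨ cong (λ z → f z - K * N) (cancel x K N) ⟩
    f x - K * N                             ≡⟨ negate (f x) K N ⟩
    f x + -[1+ k ] * N                      ∎
    where
    open ≡-Reasoning
    K : ℤ
    K = + suc k
    shift : ∀ y K N → y + K * N - K * N ≡ y
    shift = solve-∀
    cancel : ∀ x K N → x + (- K) * N + K * N ≡ x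
    cancel = solve-∀
    negate : ∀ y K N → y - K * N ≡ y + (- K) * N
    negate = solve-∀

inv-+-* : ∀ {n} (ω : ℤ ↔ ℤ) → (∀ x → app ω (x + + n) ≡ app ω x + + n) →
  ∀ y t → inv ω (y + t * + n) ≡ inv ω y + t * + n
inv-+-* {n} ω periodic y t = begin
  inv ω (y + t * + n)                ≡⟨ cong (λ z → inv ω (z + t * + n)) (Inverse.strictlyInverseˡ ω y) ⟨
  inv ω (app ω (inv ω y) + t * + n)  ≡⟨ cong (inv ω) (Periodic.f-+-* (app ω) periodic (inv ω y) t) ⟨
  inv ω (app ω (inv ω y + t * + n))  ≡⟨ Inverse.strictlyInverseʳ ω _ ⟩
  inv ω y + t * + n                  ∎
  where open ≡-Reasoning

stable-iterate : ∀ {m} (f : ℤ → ℤ) → (∀ x → f x ℤ.< f (x + + m)) → ∀ x k → f x ℤ.≤ f (x + + (k ℕ.* m))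
stable-iterate f stable x zero    = ℤP.≤-reflexive (cong f (sym (ℤP.+-identityʳ x)))
stable-iterate {m} f stable x (suc k) =
  ℤP.≤-trans (stable-iterate f stable x k)
             (ℤP.<⇒≤ (subst (λ z → f (x + + (k ℕ.* m)) ℤ.< f z) (sym regroup) (stable _)))
  where
  reassoc : ∀ x A B → x + (A + B) ≡ x + B + A
  reassoc = solve-∀
  regroup : x + + (suc k ℕ.* m) ≡ x + + (k ℕ.* m) + + m
  regroup = trans (cong (λ z → x + z) (ℤP.pos-+ m (k ℕ.* m))) (reassoc x (+ m) _)

minimalRep-< : ∀ {n} (ω : ℤ ↔ ℤ) → IsMinimalRep n ω →
  ∀ {β α} → 1 ≤ β → β < α → α ≤ n → inv ω (+ β) ℤ.< inv ω (+ α)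
minimalRep-< ω minRep {β} {suc α} 1≤β β<1+α 1+α≤n with ℕP.m≤n⇒m<n∨m≡n (ℕP.≤-pred β<1+α)
... | inj₂ refl = minRep β 1≤β 1+α≤n
... | inj₁ β<α  = ℤP.<-trans (minimalRep-< ω minRep 1≤β β<α (ℕP.<⇒≤ 1+α≤n))
                             (minRep α (ℕP.≤-trans 1≤β (ℕP.<⇒≤ β<α)) 1+α≤n)

module MinStable (m n : ℕ) (ω : ℤ ↔ ℤ) (H : IsMinStableAffPerm m n ω) (M : ℤ) (HM : IsMinPos ω M) where

  private
    f g : ℤ → ℤ
    f = app ω
    g = inv ω
    N : ℤ
    N = + n
    Δ : Subsetℕ
    Δ = Rhat ω M

  f-+-* : ∀ x t → f (x + t * N) ≡ f x + t * N
  f-+-* = Periodic.f-+-* f (proj₁ (proj₁ H))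

  g-+-* : ∀ y t → g (y + t * N) ≡ g y + t * N
  g-+-* = inv-+-* ω (proj₁ (proj₁ H))

  stable : ∀ x → f x ℤ.< f (x + + m)
  stable = proj₁ (proj₂ H)

  ∈Rhat : ∀ v → v ∈ℤ Δ ≡ does (+ 0 ℤP.<? f (M + v))
  ∈Rhat (+ k)    = refl
  ∈Rhat -[1+ k ] = sym (dec-false (+ 0 ℤP.<? _) (ℤP.≤⇒≯ (proj₂ HM _ below-M)))
    where
    below-M : M + -[1+ k ] ℤ.< M
    below-M = subst (M + -[1+ k ] ℤ.<_) (ℤP.+-identityʳ M) (ℤP.+-monoʳ-< M ℤ.-<+)

  Rhat-+m : ∀ v → v ∈ℤ Δ ≡ true → (v + + m) ∈ℤ Δ ≡ true
  Rhat-+m v v∈Δ rewrite ∈Rhat v | ∈Rhat (v + + m) with + 0 ℤP.<? f (M + v)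
  ... | yes 0<fv = dec-true (+ 0 ℤP.<? _) (ℤP.<-trans 0<fv fv<)
    where
    fv< : f (M + v) ℤ.< f (M + (v + + m))
    fv< = subst (λ z → f (M + v) ℤ.< f z) (ℤP.+-assoc M v (+ m)) (stable (M + v))

  point∈Δ : ℕ → ℕ → Bool
  point∈Δ x ρ = (+ (ρ ℕ.* m) - + (suc x ℕ.* n)) ∈ℤ Δ

  point∈Δ-upwardClosed : ∀ x → UpwardClosed (point∈Δ x)
  point∈Δ-upwardClosed x ρ inΔ = subst (λ v → v ∈ℤ Δ ≡ true) (sym regroup) (Rhat-+m (R - S) inΔ)
    where
    R S : ℤ
    R = + (ρ ℕ.* m)
    S = + (suc x ℕ.* n)
    reassoc : ∀ A B S → (A + B) - S ≡ (B - S) + A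
    reassoc = solve-∀
    regroup : + (suc ρ ℕ.* m) - S ≡ (R - S) + + m
    regroup = trans (cong (_- S) (ℤP.pos-+ m (ρ ℕ.* m))) (reassoc (+ m) R S)

  point∈Δ-outside : ∀ {x ρ} → m ≤ x → ρ < n → point∈Δ x ρ ≡ false
  point∈Δ-outside {x} {ρ} m≤x ρ<n = ∈ℤ-negative Δ negative
    where
    ρm<[1+x]n : ρ ℕ.* m < suc x ℕ.* n
    ρm<[1+x]n = ℕP.≤-<-trans (ℕP.*-monoʳ-≤ ρ (ℕP.m≤n⇒m≤1+n m≤x))
                  (subst (ρ ℕ.* suc x <_) (ℕP.*-comm n (suc x)) (ℕP.*-monoˡ-< (suc x) ρ<n))
    negative : + (ρ ℕ.* m) - + (suc x ℕ.* n) ℤ.< + 0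
    negative = subst (+ (ρ ℕ.* m) - + (suc x ℕ.* n) ℤ.<_) (ℤP.+-inverseʳ (+ (suc x ℕ.* n)))
                 (ℤP.+-monoˡ-< (- + (suc x ℕ.* n)) (+<+ ρm<[1+x]n))

  D-cell : ∀ x {y} → y < n → D m n Δ x y ≡ point∈Δ x (n ∸ suc y)
  D-cell x {y} y<n rewrite dec-true (y ℕP.<? n) y<n | lattice-point m n x y y<n with x ℕP.<? m
  ... | yes x<m rewrite dec-true (x ℕP.<? m) x<m = refl
  ... | no  x≮m rewrite dec-false (x ℕP.<? m) x≮m =
    sym (point∈Δ-outside (ℕP.≮⇒≥ x≮m) (ℕP.∸-monoʳ-< {n} {suc y} {0} (s≤s z≤n) y<n))

  module Anderson (a : Fin n → ℤ) (A : IsAnderson m n ω M a) where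

    r : Fin n → Fin n
    r i = proj₁ (A i)

    anderson-shift : ∀ i s → f (M + (+ (toℕ (r i) ℕ.* m) - s * N)) ≡ + suc (toℕ i) + (a i - s) * N
    anderson-shift i s = begin
      f (M + (R - s * N))                   ≡⟨ cong (λ z → f (M + (z - s * N))) R≡ ⟩
      f (M + (g⁻¹α - M + a i * N - s * N))  ≡⟨ cong f (regroup g⁻¹α M (a i) s N) ⟩
      f (g⁻¹α + (a i - s) * N)              ≡⟨ f-+-* g⁻¹α (a i - s) ⟩
      f g⁻¹α + (a i - s) * N                ≡⟨ cong (_+ (a i - s) * N) (Inverse.strictlyInverseˡ ω _) ⟩
      + suc (toℕ i) + (a i - s) * N         ∎
      where
      open ≡-Reasoning
      R g⁻¹α : ℤ
      R = + (toℕ (r i) ℕ.* m)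
      g⁻¹α = g (+ suc (toℕ i))
      unshift : ∀ R A N → R - A * N + A * N ≡ R
      unshift = solve-∀
      regroup : ∀ G M A S N → M + (G - M + A * N - S * N) ≡ G + (A - S) * N
      regroup = solve-∀
      R≡ : R ≡ g⁻¹α - M + a i * N
      R≡ = trans (sym (unshift R (a i) N)) (cong (_+ a i * N) (sym (proj₂ (A i))))

    anderson-nonneg : ∀ i → + 0 ℤ.≤ a i
    anderson-nonneg i = Equivalence.to (window-pos (s≤s z≤n) (FinP.toℕ<n i) (a i))
      (subst (+ 0 ℤ.<_) f[M+R]≡ (ℤP.<-≤-trans (proj₁ HM) (stable-iterate f stable M (toℕ (r i)))))
      where
      R : ℤ
      R = + (toℕ (r i) ℕ.* m)
      drop0 : ∀ M R N → M + R ≡ M + (R - + 0 * N)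
      drop0 = solve-∀
      drop0′ : ∀ A → A - + 0 ≡ A
      drop0′ = solve-∀
      f[M+R]≡ : f (M + R) ≡ + suc (toℕ i) + a i * N
      f[M+R]≡ = trans (cong f (drop0 M R N))
                  (trans (anderson-shift i (+ 0)) (cong (λ z → + suc (toℕ i) + z * N) (drop0′ (a i))))

    <-anderson : ∀ i x → (x <ᵇ ∣ a i ∣) ≡ point∈Δ x (toℕ (r i))
    <-anderson i x = begin
      does (x ℕP.<? k)                                ≡⟨ does-⇔ x<k⇔ (x ℕP.<? k) (+ 0 ℤP.<? _) ⟩
      does (+ 0 ℤP.<? f (M + (R - + suc x * N)))      ≡⟨ cong (λ z → does (+ 0 ℤP.<? f (M + (R - z))))
                                                              (ℤP.pos-* (suc x) n) ⟨
      does (+ 0 ℤP.<? f (M + (R - + (suc x ℕ.* n))))  ≡⟨ ∈Rhat (R - + (suc x ℕ.* n)) ⟨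
      point∈Δ x (toℕ (r i))                           ∎
      where
      open ≡-Reasoning
      k : ℕ
      k = ∣ a i ∣
      R : ℤ
      R = + (toℕ (r i) ℕ.* m)
      window : (+ 0 ℤ.< + suc (toℕ i) + (+ k - + suc x) * N) ⇔ (+ 0 ℤ.≤ + k - + suc x)
      window = window-pos (s≤s z≤n) (FinP.toℕ<n i) (+ k - + suc x)
      shift : f (M + (R - + suc x * N)) ≡ + suc (toℕ i) + (+ k - + suc x) * N
      shift = trans (anderson-shift i (+ suc x))
                    (cong (λ z → + suc (toℕ i) + (z - + suc x) * N) (sym (ℤP.0≤i⇒+∣i∣≡i (anderson-nonneg i))))
      x<k⇔ : (x < k) ⇔ (+ 0 ℤ.< f (M + (R - + suc x * N)))
      x<k⇔ = mk⇔
        (λ x<k → subst (+ 0 ℤ.<_) (sym shift) (Equivalence.from window (ℤP.i≤j⇒0≤j-i (+≤+ x<k))))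
        (λ pos → ℤP.drop‿+≤+ (ℤP.0≤i-j⇒j≤i (Equivalence.to window (subst (+ 0 ℤ.<_) shift pos))))

    r-injective : Injective _≡_ _≡_ r
    r-injective {i} {j} ri≡rj = FinP.toℕ-injective (ℕP.suc-injective (sym α-j≡α-i))
      where
      cancel : ∀ A N → A + (a i - a i) * N ≡ A
      cancel A N = trans (cong (λ z → A + z * N) (ℤP.+-inverseʳ (a i))) (lem A N)
        where
        lem : ∀ A N → A + + 0 * N ≡ A
        lem = solve-∀
      same-point : + suc (toℕ j) + (a j - a i) * N ≡ + suc (toℕ i)
      same-point = begin
        + suc (toℕ j) + (a j - a i) * N          ≡⟨ anderson-shift j (a i) ⟨
        f (M + (+ (toℕ (r j) ℕ.* m) - a i * N))  ≡⟨ cong (λ ρ → f (M + (+ (toℕ ρ ℕ.* m) - a i * N))) ri≡rj ⟨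
        f (M + (+ (toℕ (r i) ℕ.* m) - a i * N))  ≡⟨ anderson-shift i (a i) ⟩
        + suc (toℕ i) + (a i - a i) * N          ≡⟨ cancel _ N ⟩
        + suc (toℕ i)                            ∎
        where open ≡-Reasoning
      α-j≡α-i : suc (toℕ j) ≡ suc (toℕ i)
      α-j≡α-i = window-rigid (a j - a i) (s≤s z≤n) (FinP.toℕ<n j) (s≤s z≤n) (FinP.toℕ<n i) same-point

    anderson-diagram : P (λ i → ∣ a i ∣) ≈D D m n Δ
    anderson-diagram x y = trans (P-count (λ i → ∣ a i ∣) x y) (trans (cong (y <ᵇ_) columns) (by-row y))
      where
      columns : countFin (λ i → x <ᵇ ∣ a i ∣) ≡ countFin {n} (point∈Δ x ∘ toℕ)
      columns = countFin-reindex r r-injective (λ i → <-anderson i x)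
      by-row : ∀ y → (y <ᵇ countFin {n} (point∈Δ x ∘ toℕ)) ≡ D m n Δ x y
      by-row y with y ℕP.<? n
      ... | yes y<n =
        trans (countFin-upwardClosed n (point∈Δ x) (point∈Δ-upwardClosed x) y<n) (sym (D-cell x y<n))
      ... | no  y≮n rewrite dec-false (y ℕP.<? n) y≮n =
        trans (dec-false (y ℕP.<? _) (ℕP.≤⇒≯ (ℕP.≤-trans (countFin-≤ {n} (point∈Δ x ∘ toℕ)) (ℕP.≮⇒≥ y≮n))))
              (sym (BoolP.∧-zeroʳ (x <ᵇ m)))

  sharedRow : ℕ → ℕ
  sharedRow β = count (λ t → does (f (g (+ β) + + t) ℤP.<? + β)) (oneTo (m ∸ 1))

  PS-star : ∀ i → PS m n (star ω) i ≡ sharedRow (n ∸ toℕ i)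
  PS-star i = count-applyUpTo-cong _ _ suc suc (m ∸ 1)
                (λ {t} _ → does-⇔ (swap (suc t)) (α ℤP.<? _) (f (g β + + suc t) ℤP.<? β))
    where
    α β : ℤ
    α = + suc (toℕ i)
    β = + (n ∸ toℕ i)
    β≡ : β ≡ (+ 1 + N) - α
    β≡ = sym (trans (ℤP.m-n≡m⊖n (suc n) (suc (toℕ i))) (ℤP.⊖-≥ (s≤s (ℕP.<⇒≤ (FinP.toℕ<n i)))))
    reflect : + 1 - α ≡ β + (- + 1) * N
    reflect = trans (lem α N) (cong (_+ (- + 1) * N) (sym β≡))
      where
      lem : ∀ A N → + 1 - A ≡ (+ 1 + N) - A + (- + 1) * N
      lem = solve-∀
    star-value : ∀ t → app (star ω) (inv (star ω) α - + t) ≡ (+ 1 + N) - f (g β + + t)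
    star-value t = begin
      + 1 - f (+ 1 - ((+ 1 - g (+ 1 - α)) - + t))          ≡⟨ cong (λ z → + 1 - f (+ 1 - ((+ 1 - g z) - + t)))
                                                                    reflect ⟩
      + 1 - f (+ 1 - ((+ 1 - g (β + (- + 1) * N)) - + t))  ≡⟨ cong (λ z → + 1 - f (+ 1 - ((+ 1 - z) - + t)))
                                                                    (g-+-* β (- + 1)) ⟩
      + 1 - f (+ 1 - ((+ 1 - (g β + (- + 1) * N)) - + t))  ≡⟨ cong (λ z → + 1 - f z) (regroup (g β) (+ t) N) ⟩
      + 1 - f ((g β + + t) + (- + 1) * N)                   ≡⟨ cong (λ z → + 1 - z) (f-+-* (g β + + t) (- + 1)) ⟩
      + 1 - (f (g β + + t) + (- + 1) * N)                   ≡⟨ unfold (f (g β + + t)) N ⟩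
      (+ 1 + N) - f (g β + + t)                             ∎
      where
      open ≡-Reasoning
      regroup : ∀ G T N → + 1 - ((+ 1 - (G + (- + 1) * N)) - T) ≡ (G + T) + (- + 1) * N
      regroup = solve-∀
      unfold : ∀ F N → + 1 - (F + (- + 1) * N) ≡ (+ 1 + N) - F
      unfold = solve-∀
    swap : ∀ t → (α ℤ.< app (star ω) (inv (star ω) α - + t)) ⇔ (f (g β + + t) ℤ.< β)
    swap t = mk⇔
      (λ α<⋆ → subst (F ℤ.<_) (sym β≡) (<-swap α F (+ 1 + N) (subst (α ℤ.<_) (star-value t) α<⋆)))
      (λ F<β → subst (α ℤ.<_) (sym (star-value t)) (<-swap F α (+ 1 + N) (subst (F ℤ.<_) β≡ F<β)))
      where
      F : ℤ
      F = f (g β + + t)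

  Gval-sharedRow : 1 ≤ m → ∀ {β} → 1 ≤ β → β ≤ n → ∀ u → M + + u ≡ g (+ β) → Gval m Δ u ≡ sharedRow β
  Gval-sharedRow 1≤m {β} 1≤β β≤n u M+u≡gβ =
    count-applyUpTo-interior (λ k → not (Δ k)) (λ t → does (F t ℤP.<? + β)) u m 1≤m
      (cong not u∈Δ) (cong not u+m∈Δ) interior
    where
    F : ℕ → ℤ
    F t = f (g (+ β) + + t)
    shift : ∀ t → M + + (u ℕ.+ t) ≡ g (+ β) + + t
    shift t = trans (cong (λ z → M + z) (ℤP.pos-+ u t))
                    (trans (sym (ℤP.+-assoc M (+ u) (+ t))) (cong (_+ + t) M+u≡gβ))
    Δ≡ : ∀ t → Δ (u ℕ.+ t) ≡ does (+ 0 ℤP.<? F t)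
    Δ≡ t = cong (λ z → does (+ 0 ℤP.<? f z)) (shift t)
    0<fgβ : + 0 ℤ.< f (g (+ β))
    0<fgβ = subst (+ 0 ℤ.<_) (sym (Inverse.strictlyInverseˡ ω (+ β))) (+<+ 1≤β)
    u∈Δ : Δ u ≡ true
    u∈Δ = dec-true (+ 0 ℤP.<? _) (subst (λ z → + 0 ℤ.< f z) (sym M+u≡gβ) 0<fgβ)
    u+m∈Δ : Δ (u ℕ.+ m) ≡ true
    u+m∈Δ = trans (Δ≡ m) (dec-true (+ 0 ℤP.<? _) (ℤP.<-trans 0<fgβ (stable (g (+ β)))))
    interior : ∀ {t} → 1 ≤ t → t < m → not (Δ (u ℕ.+ t)) ≡ does (F t ℤP.<? + β)
    interior {t} 1≤t _ =
      trans (cong not (Δ≡ t)) (does-⇔ (mk⇔ to from) (¬? (+ 0 ℤP.<? F t)) (F t ℤP.<? + β))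
      where
      to : ¬ (+ 0 ℤ.< F t) → F t ℤ.< + β
      to F≯0 = ℤP.≤-<-trans (ℤP.≮⇒≥ F≯0) (+<+ 1≤β)
      -- A value 0 < β′ < β at position ω⁻¹(β) + t would put ω⁻¹(β′) after ω⁻¹(β).
      from : F t ℤ.< + β → ¬ (+ 0 ℤ.< F t)
      from F<β 0<F = ℤP.<-asym (minimalRep-< ω (proj₂ (proj₂ H)) 1≤β′ β′<β β≤n)
                               (subst (g (+ β) ℤ.<_) (sym gβ′≡) gβ<)
        where
        β′ : ℕ
        β′ = ∣ F t ∣
        +β′≡F : + β′ ≡ F t
        +β′≡F = ℤP.0≤i⇒+∣i∣≡i (ℤP.<⇒≤ 0<F)
        1≤β′ : 1 ≤ β′
        1≤β′ = ℤP.drop‿+<+ (subst (+ 0 ℤ.<_) (sym +β′≡F) 0<F)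
        β′<β : β′ < β
        β′<β = ℤP.drop‿+<+ (subst (ℤ._< + β) (sym +β′≡F) F<β)
        gβ′≡ : g (+ β′) ≡ g (+ β) + + t
        gβ′≡ = trans (cong g +β′≡F) (Inverse.strictlyInverseʳ ω _)
        gβ< : g (+ β) ℤ.< g (+ β) + + t
        gβ< = subst (ℤ._< g (+ β) + + t) (ℤP.+-identityʳ (g (+ β))) (ℤP.+-monoʳ-< (g (+ β)) (+<+ 1≤t))

  generator-window : ∀ {v} → IsNGen n Δ v → ∃ λ (k : Fin n) → f (M + + v) ≡ + suc (toℕ k)
  generator-window {v} (v∈Δ , v-n∉Δ) = proj₁ index , trans (sym +γ≡F) (cong +_ (sym (proj₂ index)))
    where
    F : ℤ
    F = f (M + + v)
    shift : f (M + (+ v - N)) ≡ F - N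
    shift = trans (cong f (regroup M (+ v) N)) (trans (f-+-* (M + + v) (- + 1)) (unfold F N))
      where
      regroup : ∀ M V N → M + (V - N) ≡ (M + V) + (- + 1) * N
      regroup = solve-∀
      unfold : ∀ F N → F + (- + 1) * N ≡ F - N
      unfold = solve-∀
    0<F : + 0 ℤ.< F
    0<F = does-true⇒ (+ 0 ℤP.<? F) v∈Δ
    F≤N : F ℤ.≤ N
    F≤N = ℤP.i-j≤0⇒i≤j (subst (ℤ._≤ + 0) shift
            (ℤP.≮⇒≥ (does-false⇒ (+ 0 ℤP.<? _) (trans (sym (∈Rhat (+ v - N))) v-n∉Δ))))
    +γ≡F : + ∣ F ∣ ≡ F
    +γ≡F = ℤP.0≤i⇒+∣i∣≡i (ℤP.<⇒≤ 0<F)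
    1≤γ : 1 ≤ ∣ F ∣
    1≤γ = ℤP.drop‿+<+ (subst (+ 0 ℤ.<_) (sym +γ≡F) 0<F)
    γ≤n : ∣ F ∣ ≤ n
    γ≤n = ℤP.drop‿+≤+ (subst (ℤ._≤ N) (sym +γ≡F) F≤N)
    index : ∃ λ (k : Fin n) → suc (toℕ k) ≡ ∣ F ∣
    index = window-index 1≤γ γ≤n

  PS-row : ∀ i → PS m n (star ω) i ≡ sharedRow (suc (toℕ (Fin.opposite i)))
  PS-row i = trans (PS-star i) (cong sharedRow (trans (ℕP.+-∸-assoc 1 (FinP.toℕ<n i))
                                                     (cong suc (sym (FinP.opposite-prop i)))))

  module Generators (1≤m : 1 ≤ m) (u : Fin n → ℕ) (U : IsNGenList n Δ u) where

    σ : Fin n → Fin n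
    σ j = proj₁ (generator-window (proj₁ (proj₂ U) j))

    f[M+u]≡ : ∀ j → f (M + + u j) ≡ + suc (toℕ (σ j))
    f[M+u]≡ j = proj₂ (generator-window (proj₁ (proj₂ U) j))

    M+u≡ : ∀ j → M + + u j ≡ g (+ suc (toℕ (σ j)))
    M+u≡ j = trans (sym (Inverse.strictlyInverseʳ ω _)) (cong g (f[M+u]≡ j))

    σ-injective : Injective _≡_ _≡_ σ
    σ-injective {i} {j} σi≡σj = strictlyIncreasing⇒injective (proj₁ U)
      (ℤP.+-injective (∙-cancelˡ M (+ u i) (+ u j)
        (trans (M+u≡ i) (trans (cong (λ k → g (+ suc (toℕ k))) σi≡σj) (sym (M+u≡ j))))))

    G-row : ∀ j → Gval m Δ (u j) ≡ sharedRow (suc (toℕ (σ j)))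
    G-row j = Gval-sharedRow 1≤m (s≤s z≤n) (FinP.toℕ<n (σ j)) (u j) (M+u≡ j)

    PS-star-diagram : P (PS m n (star ω)) ≈D G m Δ u
    PS-star-diagram x y =
      trans (P-reindex {g = row} Fin.opposite opposite-injective PS-row x y)
            (sym (P-reindex {g = row} σ σ-injective G-row x y))
      where
      row : Fin n → ℕ
      row k = sharedRow (suc (toℕ k))

mainTheorem5 : (m n : ℕ) → 1 ≤ m → 1 ≤ n → Coprime m n →
    (ω : ℤ ↔ ℤ) → IsMinStableAffPerm m n ω →
    (M : ℤ) → IsMinPos ω M →
    ((a : Fin n → ℤ) → IsAnderson m n ω M a →
       (∀ i → + 0 ℤ.≤ a i) × (P (λ i → ∣ a i ∣) ≈D D m n (Rhat ω M)))
    ×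
    ((u : Fin n → ℕ) → IsNGenList n (Rhat ω M) u →
       P (PS m n (star ω)) ≈D G m (Rhat ω M) u)
mainTheorem5 m n 1≤m _ _ ω H M HM =
  (λ a A → let open MinStable.Anderson m n ω H M HM a A in anderson-nonneg , anderson-diagram) ,
  (λ u U → MinStable.Generators.PS-star-diagram m n ω H M HM 1≤m u U)
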